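{- The following algorithm for Brouwerian difference is minimally and optimally lazy. Algorithm: keep a current interval $[\ell'\..r']$ of $S$, initially $[-\infty\..-\infty]$. next: while $M$ is not exhausted do \{ $[\ell\..r]\leftarrow$ next$(M)$; while $\ell'<\ell$ and $r'<r$ and $S$ is not exhausted do $[\ell'\..r']\leftarrow$ next$(S)$; if $S$ is exhausted or $[\ell'\..r']\not\subseteq[\ell\..r]$ then return $[\ell\..r]$ \}; return $\text{null}$.
   Context: Let $O$ be a finite totally ordered set about which algorithms know only a comparison operator; $\pm\infty$ denote special elements strictly smaller/larger than every element of $O$. A subset $X\subseteq O$ is an interval if $x,y\in X$, $x<z<y$ imply $z\in X$; nonempty intervals are written $[\ell\..r]$. An antichain of intervals is a set of intervals pairwise incomparable under inclusion, listed in natural order (by left extreme). Inputs are two lists $M$ (list $0$) and $S$ (list $1$), each a nonempty antichain of nonempty intervals, accessed only via a next function returning the next interval in natural order and $\text{null}$ once exhausted. The Brouwerian difference $M-S$ is the set of intervals $I\in M$ for which there is no $J\in S$ with $J\subseteq I$; an algorithm for it produces these intervals as an output list. Laziness: $\rho_i^{\mathscr A}(I,p)$ is the number of elements (including possibly $\text{null}$) read by algorithm $\mathscr A$ from the $i$-th list of input $I$ when its $p$-th output is produced ($p$ at most the number of outputs). Algorithms are functionally equivalent if they give the same output list on the same inputs. $\mathscr A$ is $k$-lazy if for every functionally equivalent $\mathscr B$ and all $I,i,p$, $\rho_i^{\mathscr A}(I,p)\le\rho_i^{\mathscr B}(I,p)+k$; optimally lazy if $k$-lazy for some $k$ while no functionally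 equivalent algorithm is $(k-1)$-lazy (no algorithm is $k$-lazy for $k<0$); minimally lazy if every functionally equivalent $\mathscr B$ with $\rho_i^{\mathscr B}(I,p)\le\rho_i^{\mathscr A}(I,p)$ for all $I,i,p$ has equality for all $I,i,p$. -}

module Defs where

open import Data.Nat using (ℕ; zero; suc; _+_; _∸_; _≤_; _<ᵇ_)
open import Data.Fin using (Fin; toℕ) renaming (zero to f0; suc to fs)
open import Data.Bool using (Bool; true; false; if_then_else_)
open import Data.List using (List; []; _∷_; map; reverse; _∷ʳ_; foldr)
open import Data.List.Relation.Unary.Any using (Any)
open import Data.List.Relation.Unary.All using (All)
open import Data.List.Relation.Unary.AllPairs using (AllPairs)
open import Data.Maybe using (Maybe; just; nothing)
open import Data.Product using (Σ; _×_; _,_; ∃)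
open import Relation.Nullary using (¬_)
open import Relation.Binary.PropositionalEquality using (_≡_; _≢_)
open import Function.Bundles using (_⇔_)

-- A finite totally ordered set is (up to order
-- isomorphism) some Fin n with the order of toℕ; all notions below are
-- parametric in n, and algorithms are uniform in n (comparison-only).

record Interval (n : ℕ) : Set where
  constructor [_⋯_]
  field
    lft rgt : Fin n
open Interval public

_∈ᵢ_ : ∀ {n} → Fin n → Interval n → Set
x ∈ᵢ I = toℕ (lft I) ≤ toℕ x × toℕ x ≤ toℕ (rgt I)

_⊆ᵢ_ : ∀ {n} → Interval n → Interval n → Set
I ⊆ᵢ J = ∀ x → x ∈ᵢ I → x ∈ᵢ J

NonEmptyInterval : ∀ {n} → Interval n → Set
NonEmptyInterval {n} I = Σ (Fin n) (λ x → x ∈ᵢ I)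

Antichain : ∀ {n} → List (Interval n) → Set
Antichain xs =
  (xs ≢ []) ×
  All NonEmptyInterval xs ×
  AllPairs (λ I J → (toℕ (lft I) ≤ toℕ (lft J)) × ¬ (I ⊆ᵢ J) × ¬ (J ⊆ᵢ I)) xs

record Input (n : ℕ) : Set where
  constructor input
  field
    M S : List (Interval n)
open Input public

Valid : ∀ {n} → Input n → Set
Valid I = Antichain (M I) × Antichain (S I)

lst : ∀ {n} → Input n → Fin 2 → List (Interval n)
lst I f0 = M I
lst I (fs _) = S I

Contains : ∀ {n} → List (Interval n) → Interval n → Set
Contains Sl I = Any (λ J → J ⊆ᵢ I) Sl

data IsDiff {n : ℕ} (Sl : List (Interval n)) :
       List (Interval n) → List (Interval n) → Set where
  done : IsDiff Sl [] []
  keep : ∀ {I Ml L} → ¬ Contains Sl I → IsDiff Sl Ml L → IsDiff Sl (I ∷ Ml) (I ∷ L)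
  skip : ∀ {I Ml L} → Contains Sl I → IsDiff Sl Ml L → IsDiff Sl (I ∷ Ml) L

-- An algorithm chooses its next action as a function of the history of
-- responses it has received (newest first).  It can read the next element
-- of a list (learning only whether it is null), compare two endpoints of
-- intervals it has already read, emit (output) an interval it has already
-- read, or halt (which is the final `null' output).

data Side : Set where
  L R : Side

data Cmp : Set where
  lt eq gt : Cmp

record Ref : Set where
  constructor ref
  field
    which : Fin 2
    idx   : ℕ
    side  : Side

data Action : Set where
  read    : Fin 2 → Action
  compare : Ref → Ref → Action
  emit    : Fin 2 → ℕ → Action
  halt    : Action

data Response : Set where
  got null ack : Response
  cmp : Cmp → Response

Algorithm : Set
Algorithm = List Response → Action

cmpℕ : ℕ → ℕ → Cmp
cmpℕ zero zero = eq
cmpℕ zero (suc _) = lt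
cmpℕ (suc _) zero = gt
cmpℕ (suc a) (suc b) = cmpℕ a b

nth : ∀ {A : Set} → List A → ℕ → Maybe A
nth [] _ = nothing
nth (x ∷ _) zero = just x
nth (_ ∷ xs) (suc k) = nth xs k

bump : Fin 2 → (Fin 2 → ℕ) → Fin 2 → ℕ
bump f0 c f0 = suc (c f0)
bump f0 c (fs j) = c (fs j)
bump (fs i) c f0 = c f0
bump (fs i) c (fs j) = suc (c (fs j))

-- an interval already read (c i = number of elements read from list i)
fetch : ∀ {n} → Input n → (Fin 2 → ℕ) → Fin 2 → ℕ → Maybe (Interval n)
fetch I c i k = if k <ᵇ c i then nth (lst I i) k else nothing

endpoint : ∀ {n} → Side → Interval n → Fin n
endpoint L J = lft J
endpoint R J = rgt J

deref : ∀ {n} → Input n → (Fin 2 → ℕ) → Ref → Maybe (Fin n)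
deref I c (ref i k s) with fetch I c i k
... | just J = just (endpoint s J)
... | nothing = nothing

-- one output: its value (nothing = null) and the number of elements read
-- so far from each list
record Out (n : ℕ) : Set where
  constructor out
  field
    val   : Maybe (Interval n)
    nread : Fin 2 → ℕ
open Out public

run : ∀ {n} → ℕ → Algorithm → Input n → List Response → (Fin 2 → ℕ) →
      List (Out n) → Maybe (List (Out n))
runAct : ∀ {n} → ℕ → Algorithm → Input n → List Response → (Fin 2 → ℕ) →
         List (Out n) → Action → Maybe (List (Out n))
runCmp : ∀ {n} → ℕ → Algorithm → Input n → List Response → (Fin 2 → ℕ) →
         List (Out n) → Maybe (Fin n) → Maybe (Fin n) → Maybe (List (Out n))
runRead : ∀ {n} → ℕ → Algorithm → Input n → List Response → (Fin 2 → ℕ) →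
          List (Out n) → Fin 2 → Maybe (Interval n) → Maybe (List (Out n))
runEmit : ∀ {n} → ℕ → Algorithm → Input n → List Response → (Fin 2 → ℕ) →
          List (Out n) → Maybe (Interval n) → Maybe (List (Out n))

run zero X I h c acc = nothing
run (suc f) X I h c acc = runAct f X I h c acc (X h)

runAct f X I h c acc (read i) = runRead f X I h c acc i (nth (lst I i) (c i))
runAct f X I h c acc (compare a b) = runCmp f X I h c acc (deref I c a) (deref I c b)
runAct f X I h c acc (emit i k) = runEmit f X I h c acc (fetch I c i k)
runAct f X I h c acc halt = just (reverse (out nothing c ∷ acc))

runRead f X I h c acc i (just _) = run f X I (got ∷ h) (bump i c) acc
runRead f X I h c acc i nothing = run f X I (null ∷ h) (bump i c) acc

runCmp f X I h c acc (just x) (just y) = run f X I (cmp (cmpℕ (toℕ x) (toℕ y)) ∷ h) c acc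
runCmp f X I h c acc _ _ = nothing

runEmit f X I h c acc (just J) = run f X I (ack ∷ h) c (out (just J) c ∷ acc)
runEmit f X I h c acc nothing = nothing

Runs : ∀ {n} → Algorithm → Input n → List (Out n) → Set
Runs X I tr = ∃ λ fuel → run fuel X I [] (λ _ → 0) [] ≡ just tr

Computes : ∀ {n} → Algorithm → Input n → List (Maybe (Interval n)) → Set
Computes X I vs = ∃ λ tr → Runs X I tr × map val tr ≡ vs

FunEquiv : Algorithm → Algorithm → Set
FunEquiv X Y = ∀ n (I : Input n) → Valid I → ∀ vs → Computes X I vs ⇔ Computes Y I vs

-- ρ_i^X(I,p) = a  (p counted from 0)
Rho : ∀ {n} → Algorithm → Input n → Fin 2 → ℕ → ℕ → Set
Rho X I i p a = ∃ λ tr → Runs X I tr × ∃ λ o → nth tr p ≡ just o × nread o i ≡ a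

Lazy : Algorithm → ℕ → Set
Lazy X k = ∀ Y → FunEquiv X Y → ∀ n (I : Input n) → Valid I →
  ∀ i p a b → Rho X I i p a → Rho Y I i p b → a ≤ b + k

OptimallyLazy : Algorithm → Set
OptimallyLazy X = Σ ℕ λ k → Lazy X k ×
  (∀ j → suc j ≡ k → ∀ Y → FunEquiv X Y → ¬ Lazy Y j)

MinimallyLazy : Algorithm → Set
MinimallyLazy X = ∀ Y → FunEquiv X Y →
  (∀ n (I : Input n) → Valid I → ∀ i p a b → Rho X I i p a → Rho Y I i p b → b ≤ a) →
  (∀ n (I : Input n) → Valid I → ∀ i p a b → Rho X I i p a → Rho Y I i p b → b ≡ a)

ComputesDiff : Algorithm → Set
ComputesDiff X = ∀ n (I : Input n) → Valid I →
  Σ (List (Interval n)) λ Ls → IsDiff (S I) (M I) Ls × Computes X I (map just Ls ∷ʳ nothing)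

-- The algorithm of the statement, as a state machine.
-- m = number of (non-null) M intervals read, current [l..r] = M[m-1];
-- s = number of non-null S intervals read, current [l'..r'] = S[s-1]
-- (s = 0 means [l'..r'] = [-∞..-∞]); sExh = S exhausted.

data PC : Set where
  RM CL CR RS C1 C2 EM DN : PC

record St : Set where
  constructor st
  field
    pc   : PC
    m s  : ℕ
    sExh : Bool

mL : ℕ → Ref
mL m = ref f0 (m ∸ 1) L
mR : ℕ → Ref
mR m = ref f0 (m ∸ 1) R
sL : ℕ → Ref
sL s = ref (fs f0) (s ∸ 1) L
sR : ℕ → Ref
sR s = ref (fs f0) (s ∸ 1) R

-- test of the inner while:  l' < l and r' < r and S not exhausted
loopEntry : ℕ → ℕ → Bool → St
exitLoop  : ℕ → ℕ → Bool → St
loopEntry m s true = exitLoop m s true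
loopEntry m zero false = st RS m zero false      -- -∞ < l and -∞ < r
loopEntry m (suc s) false = st CL m (suc s) false

-- if S exhausted or [l'..r'] ⊄ [l..r] return [l..r]
exitLoop m s true = st EM m s true
exitLoop m zero false = st EM m zero false
exitLoop m (suc s) false = st C1 m (suc s) false

stepA : St → Action
stepA (st RM m s e) = read f0
stepA (st CL m s e) = compare (sL s) (mL m)
stepA (st CR m s e) = compare (sR s) (mR m)
stepA (st RS m s e) = read (fs f0)
stepA (st C1 m s e) = compare (mL m) (sL s)
stepA (st C2 m s e) = compare (sR s) (mR m)
stepA (st EM m s e) = emit f0 (m ∸ 1)
stepA (st DN m s e) = halt

updA : St → Response → St
updA (st RM m s e) got = loopEntry (suc m) s e
updA (st RM m s e) _ = st DN m s e
updA (st CL m s e) (cmp lt) = st CR m s e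
updA (st CL m s e) _ = exitLoop m s e
updA (st CR m s e) (cmp lt) = st RS m s e
updA (st CR m s e) _ = exitLoop m s e
updA (st RS m s e) got = loopEntry m (suc s) e
updA (st RS m s e) _ = exitLoop m s true
updA (st C1 m s e) (cmp gt) = st EM m s e
updA (st C1 m s e) _ = st C2 m s e
updA (st C2 m s e) (cmp gt) = st EM m s e
updA (st C2 m s e) _ = st RM m s e
updA (st EM m s e) _ = st RM m s e
updA (st DN m s e) _ = st DN m s e

diffAlg : Algorithm
diffAlg h = stepA (foldr (λ r σ → updA σ r) (st RM 0 0 false) h)

-- Correctness: the inner loop stops at the first interval J of S not strictly before the current
-- interval I of M; since both endpoints increase strictly along an antichain, if any element of S is
-- nested in I then so is J.
-- Laziness: at each output, any functionally equivalent algorithm has read at least as much from each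
-- list.  Otherwise, enlarging the ordered set by a new maximum, the unread part of the input can be
-- replaced without changing that algorithm's outputs so far, but changing the correct ones: the unread
-- part of M by a new maximal interval, which must be output before null; the unread part of S by the
-- interval being decided, which then must not be output, or by a new maximal interval, after which it
-- must.  So the algorithm is 0-lazy, hence both minimally and optimally lazy.

module Submission where

open import Defs
open import Data.Bool using (Bool; T; false; true)
open import Data.Empty using (⊥; ⊥-elim)
open import Data.Fin using (Fin; fromℕ; inject₁; toℕ) renaming (zero to f0; suc to fs)
open import Data.Fin.Properties using (inject₁-injective; inject₁ℕ<; toℕ-fromℕ; toℕ-inject₁)
open import Data.List using (List; []; _∷_; _++_; _∷ʳ_; foldr; length; map; reverse; take)
open import Data.List.Membership.Propositional using (_∈_)
open import Data.List.Properties using (++-assoc; length-map; reverse-map; unfold-reverse)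
open import Data.List.Relation.Unary.All as All using (All; []; _∷_)
import Data.List.Relation.Unary.All.Properties as All
open import Data.List.Relation.Unary.AllPairs as AllPairs using (AllPairs; []; _∷_)
import Data.List.Relation.Unary.AllPairs.Properties as AllPairs
open import Data.List.Relation.Unary.Any using (Any; here; there)
open import Data.Maybe using (Maybe; just; nothing) renaming (map to mmap)
open import Data.Maybe.Properties using (just-injective)
open import Data.Nat using (ℕ; zero; suc; pred; _+_; _∸_; _≤_; _<_; _<ᵇ_; _≤?_; _<?_; z≤n; s≤s)
open import Data.Nat.Properties
open import Data.Product using (Σ; ∃; _×_; _,_; proj₁; proj₂)
open import Data.Sum using (_⊎_; inj₁; inj₂)
open import Data.Unit using (tt)
open import Function.Bundles using (Equivalence)
open import Relation.Binary.Definitions using (tri<; tri≈; tri>)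
open import Relation.Binary.PropositionalEquality
open import Relation.Nullary using (Dec; yes; no; ¬_)

module _ {A : Set} where

  nth-just⇒< : ∀ {xs : List A} {k x} → nth xs k ≡ just x → k < length xs
  nth-just⇒< {_ ∷ _} {zero} _ = s≤s z≤n
  nth-just⇒< {_ ∷ xs} {suc k} e = s≤s (nth-just⇒< {xs} {k} e)

  <⇒nth-just : ∀ (xs : List A) k → k < length xs → ∃ λ x → nth xs k ≡ just x
  <⇒nth-just (x ∷ _) zero _ = x , refl
  <⇒nth-just (_ ∷ xs) (suc k) (s≤s k<) = <⇒nth-just xs k k<

  length≤⇒nth-nothing : ∀ (xs : List A) k → length xs ≤ k → nth xs k ≡ nothing
  length≤⇒nth-nothing [] k _ = refl
  length≤⇒nth-nothing (_ ∷ xs) (suc k) (s≤s l) = length≤⇒nth-nothing xs k l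

  nth-++ˡ : ∀ (xs ys : List A) q → q < length xs → nth (xs ++ ys) q ≡ nth xs q
  nth-++ˡ (_ ∷ _) ys zero _ = refl
  nth-++ˡ (_ ∷ xs) ys (suc q) (s≤s q<) = nth-++ˡ xs ys q q<

  nth-∷ʳ : ∀ (xs : List A) z → nth (xs ∷ʳ z) (length xs) ≡ just z
  nth-∷ʳ [] z = refl
  nth-∷ʳ (_ ∷ xs) z = nth-∷ʳ xs z

  nth-++⁻ : ∀ {P : A → Set} (xs ys : List A) p {o} → nth (xs ++ ys) p ≡ just o → All P ys →
            p < length xs ⊎ P o
  nth-++⁻ [] (_ ∷ _) zero refl (py ∷ _) = inj₂ py
  nth-++⁻ [] (_ ∷ ys) (suc p) e (_ ∷ pys) with nth-++⁻ [] ys p e pys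
  ... | inj₂ po = inj₂ po
  nth-++⁻ (_ ∷ _) ys zero _ _ = inj₁ (s≤s z≤n)
  nth-++⁻ (_ ∷ xs) ys (suc p) e pys with nth-++⁻ xs ys p e pys
  ... | inj₁ p< = inj₁ (s≤s p<)
  ... | inj₂ po = inj₂ po

  All-nth : ∀ {P : A → Set} {xs k x} → All P xs → nth xs k ≡ just x → P x
  All-nth {k = zero} (px ∷ _) refl = px
  All-nth {k = suc k} (_ ∷ pxs) e = All-nth {k = k} pxs e

  nth⇒Any : ∀ {P : A → Set} {xs k x} → nth xs k ≡ just x → P x → Any P xs
  nth⇒Any {xs = _ ∷ _} {zero} refl px = here px
  nth⇒Any {xs = _ ∷ _} {suc k} e px = there (nth⇒Any {k = k} e px)

  Any⇒nth : ∀ {P : A → Set} {xs} → Any P xs → ∃ λ k → ∃ λ x → nth xs k ≡ just x × P x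
  Any⇒nth (here px) = 0 , _ , refl , px
  Any⇒nth (there a) with Any⇒nth a
  ... | k , x , e , px = suc k , x , e , px

  AllPairs-nth : ∀ {R : A → A → Set} {xs k k' x y} → AllPairs R xs → k < k' →
                 nth xs k ≡ just x → nth xs k' ≡ just y → R x y
  AllPairs-nth {k = zero} {suc k'} (rx ∷ _) _ refl e = All-nth {k = k'} rx e
  AllPairs-nth {k = suc k} {suc k'} (_ ∷ rxs) (s≤s k<) = AllPairs-nth {k = k} {k'} rxs k<

  nth⇒All-take : ∀ {P : A → Set} b (xs : List A) →
                 (∀ k x → k < b → nth xs k ≡ just x → P x) → All P (take b xs)
  nth⇒All-take zero xs _ = []
  nth⇒All-take (suc b) [] _ = []
  nth⇒All-take (suc b) (x ∷ xs) h =
    h 0 x (s≤s z≤n) refl ∷ nth⇒All-take b xs (λ k y k< → h (suc k) y (s≤s k<))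

module _ {A B : Set} (g : A → B) where

  nth-map : ∀ xs q → nth (map g xs) q ≡ mmap g (nth xs q)
  nth-map [] q = refl
  nth-map (_ ∷ _) zero = refl
  nth-map (_ ∷ xs) (suc q) = nth-map xs q

  nth-reverse-map : ∀ xs q → nth (reverse (map g xs)) q ≡ mmap g (nth (reverse xs) q)
  nth-reverse-map xs q = trans (cong (λ z → nth z q) (sym (reverse-map g xs))) (nth-map (reverse xs) q)

  length-reverse-map : ∀ xs → length (reverse (map g xs)) ≡ length (reverse xs)
  length-reverse-map xs = trans (cong length (sym (reverse-map g xs))) (length-map g (reverse xs))

  nth-map-take-++ : ∀ b (xs : List A) ys k → b ≤ length xs → k < b →
                    nth (map g (take b xs) ++ ys) k ≡ mmap g (nth xs k)
  nth-map-take-++ (suc b) (_ ∷ _) ys zero _ _ = refl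
  nth-map-take-++ (suc b) (_ ∷ xs) ys (suc k) (s≤s b≤) (s≤s k<) = nth-map-take-++ b xs ys k b≤ k<

terminated : ∀ {A : Set} → List A → List (Maybe A)
terminated Ls = map just Ls ∷ʳ nothing

module _ {A : Set} where

  terminated-just⁻ : ∀ (Ls : List A) q {x} → nth (terminated Ls) q ≡ just (just x) → x ∈ Ls
  terminated-just⁻ (_ ∷ _) zero refl = here refl
  terminated-just⁻ (_ ∷ Ls) (suc q) e = there (terminated-just⁻ Ls q e)
  terminated-just⁻ [] zero ()
  terminated-just⁻ [] (suc q) ()

  terminated-nothing⁻ : ∀ (Ls : List A) p → nth (terminated Ls) p ≡ just nothing → p ≡ length Ls
  terminated-nothing⁻ [] zero _ = refl
  terminated-nothing⁻ [] (suc p) ()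
  terminated-nothing⁻ (_ ∷ Ls) zero ()
  terminated-nothing⁻ (_ ∷ Ls) (suc p) e = cong suc (terminated-nothing⁻ Ls p e)

  ∈⇒terminated-just : ∀ (Ls : List A) {x} → x ∈ Ls →
                      ∃ λ q → q < length Ls × nth (terminated Ls) q ≡ just (just x)
  ∈⇒terminated-just (_ ∷ _) (here refl) = 0 , s≤s z≤n , refl
  ∈⇒terminated-just (_ ∷ Ls) (there x∈) with ∈⇒terminated-just Ls x∈
  ... | q , q< , e = suc q , s≤s q< , e

module _ {A B : Set} (g : A → B) (Ls : List A) (Ls' : List B) (p : ℕ)
         (agree : ∀ q → q ≤ p → nth (terminated Ls') q ≡ mmap (mmap g) (nth (terminated Ls) q)) where

  agreeing-output : ∀ q {x} → q ≤ p → nth (terminated Ls) q ≡ just (just x) → g x ∈ Ls'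
  agreeing-output q q≤p e = terminated-just⁻ Ls' q (trans (agree q q≤p) (cong (mmap (mmap g)) e))

  agreeing-output⁻ : nth (terminated Ls) p ≡ just nothing → ∀ {y} → y ∈ Ls' →
                     ∃ λ x → x ∈ Ls × g x ≡ y
  agreeing-output⁻ e {y} y∈ with ∈⇒terminated-just Ls' y∈
  ... | q , q< , e' with nth (terminated Ls) q in atq | agree q (<⇒≤ (subst (q <_) (sym p≡) q<))
    where
    p≡ : p ≡ length Ls'
    p≡ = terminated-nothing⁻ Ls' p (trans (agree p ≤-refl) (cong (mmap (mmap g)) e))
  ... | just (just x) | ag = x , terminated-just⁻ Ls q atq , just-injective (just-injective (trans (sym ag) e'))
  ... | just nothing | ag with () ← trans (sym ag) e'
  ... | nothing | ag with () ← trans (sym ag) e'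

module _ {n : ℕ} {Sl : List (Interval n)} where

  IsDiff-uncontained : ∀ {Ml Ls} → IsDiff Sl Ml Ls → ∀ {x} → x ∈ Ls → ¬ Contains Sl x
  IsDiff-uncontained (keep nc _) (here refl) = nc
  IsDiff-uncontained (keep _ d) (there x∈) = IsDiff-uncontained d x∈
  IsDiff-uncontained (skip _ d) x∈ = IsDiff-uncontained d x∈

  IsDiff-complete : ∀ {Ml Ls} → IsDiff Sl Ml Ls → ∀ {x} → x ∈ Ml → ¬ Contains Sl x → x ∈ Ls
  IsDiff-complete (keep _ _) (here refl) _ = here refl
  IsDiff-complete (keep _ d) (there x∈) nc = there (IsDiff-complete d x∈ nc)
  IsDiff-complete (skip c _) (here refl) nc = ⊥-elim (nc c)
  IsDiff-complete (skip _ d) (there x∈) nc = IsDiff-complete d x∈ nc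

_≺_ : ∀ {n} → Interval n → Interval n → Set
J ≺ K = toℕ (lft J) < toℕ (lft K) × toℕ (rgt J) < toℕ (rgt K)

_⊀_ : ∀ {n} → Interval n → Interval n → Set
J ⊀ K = toℕ (lft K) ≤ toℕ (lft J) ⊎ toℕ (rgt K) ≤ toℕ (rgt J)

Unnested : ∀ {n} → Interval n → Interval n → Set
Unnested I J = toℕ (lft I) ≤ toℕ (lft J) × ¬ (I ⊆ᵢ J) × ¬ (J ⊆ᵢ I)

module _ {n : ℕ} where

  bounds⇒⊆ᵢ : ∀ {A B : Interval n} → toℕ (lft B) ≤ toℕ (lft A) → toℕ (rgt A) ≤ toℕ (rgt B) →
              A ⊆ᵢ B
  bounds⇒⊆ᵢ l r x (a , b) = ≤-trans l a , ≤-trans b r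

  ⊆ᵢ⇒bounds : ∀ {A B : Interval n} → NonEmptyInterval A → A ⊆ᵢ B →
              toℕ (lft B) ≤ toℕ (lft A) × toℕ (rgt A) ≤ toℕ (rgt B)
  ⊆ᵢ⇒bounds {A} (_ , a , b) A⊆B =
    proj₁ (A⊆B (lft A) (≤-refl , ≤-trans a b)) , proj₂ (A⊆B (rgt A) (≤-trans a b , ≤-refl))

  ⊆ᵢ-refl : ∀ {A : Interval n} → A ⊆ᵢ A
  ⊆ᵢ-refl _ x∈ = x∈

  ≺-trans : ∀ {I J K : Interval n} → I ≺ J → J ≺ K → I ≺ K
  ≺-trans (a , b) (c , d) = <-trans a c , <-trans b d

  ≺⇒⊈ : ∀ {J K : Interval n} → NonEmptyInterval J → J ≺ K → ¬ (J ⊆ᵢ K)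
  ≺⇒⊈ neJ (l< , _) J⊆K = <⇒≱ l< (proj₁ (⊆ᵢ⇒bounds neJ J⊆K))

  ≺⇒⊉ : ∀ {J K : Interval n} → NonEmptyInterval K → J ≺ K → ¬ (K ⊆ᵢ J)
  ≺⇒⊉ neK (_ , r<) K⊆J = <⇒≱ r< (proj₂ (⊆ᵢ⇒bounds neK K⊆J))

  ≺⇒unnested : ∀ {J K : Interval n} → NonEmptyInterval J → NonEmptyInterval K → J ≺ K → Unnested J K
  ≺⇒unnested neJ neK J≺K = <⇒≤ (proj₁ J≺K) , ≺⇒⊈ neJ J≺K , ≺⇒⊉ neK J≺K

  unnested⇒≺ : ∀ {A B : Interval n} → Unnested A B → A ≺ B
  unnested⇒≺ {A} {B} (l≤ , A⊈B , B⊈A) = l< , r<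
    where
    r< : toℕ (rgt A) < toℕ (rgt B)
    r< with toℕ (rgt A) <? toℕ (rgt B)
    ... | yes p = p
    ... | no ¬p = ⊥-elim (B⊈A (bounds⇒⊆ᵢ l≤ (≮⇒≥ ¬p)))
    l< : toℕ (lft A) < toℕ (lft B)
    l< with toℕ (lft A) <? toℕ (lft B)
    ... | yes p = p
    ... | no ¬p = ⊥-elim (A⊈B (bounds⇒⊆ᵢ (≮⇒≥ ¬p) (<⇒≤ r<)))

  contains? : ∀ (K : Interval n) {xs} → All NonEmptyInterval xs → Dec (Contains xs K)
  contains? K [] = no λ ()
  contains? K {x ∷ _} (neX ∷ nes)
    with toℕ (lft K) ≤? toℕ (lft x) | toℕ (rgt x) ≤? toℕ (rgt K) | contains? K nes
  ... | yes l | yes r | _ = yes (here (bounds⇒⊆ᵢ l r))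
  ... | _ | _ | yes c = yes (there c)
  ... | no ¬l | _ | no ¬c = no λ { (here x⊆K) → ¬l (proj₁ (⊆ᵢ⇒bounds neX x⊆K)) ; (there c) → ¬c c }
  ... | yes _ | no ¬r | no ¬c = no λ { (here x⊆K) → ¬r (proj₂ (⊆ᵢ⇒bounds neX x⊆K)) ; (there c) → ¬c c }

  ∷ʳ-uncontained : ∀ {ys : List (Interval n)} {Z K} → All NonEmptyInterval ys → All (_≺ K) ys →
                   ¬ (Z ⊆ᵢ K) → ¬ Contains (ys ∷ʳ Z) K
  ∷ʳ-uncontained nes ≺s Z⊈K =
    All.All¬⇒¬Any (All.++⁺ (All.zipWith (λ (neY , Y≺K) → ≺⇒⊈ neY Y≺K) (nes , ≺s)) (Z⊈K ∷ []))

module _ {n : ℕ} {xs : List (Interval n)} (ac : Antichain xs) where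

  antichain-≺ : ∀ {k k' A B} → k < k' → nth xs k ≡ just A → nth xs k' ≡ just B → A ≺ B
  antichain-≺ k< eA eB = unnested⇒≺ (AllPairs-nth (proj₂ (proj₂ ac)) k< eA eB)

  antichain-nth-injective : ∀ {k k' A} → nth xs k ≡ just A → nth xs k' ≡ just A → k ≡ k'
  antichain-nth-injective {k} {k'} e e' with <-cmp k k'
  ... | tri< k< _ _ = ⊥-elim (<-irrefl refl (proj₁ (antichain-≺ k< e e')))
  ... | tri≈ _ k≡ _ = k≡
  ... | tri> _ _ k> = ⊥-elim (<-irrefl refl (proj₁ (antichain-≺ k> e' e)))

  antichain-nonEmpty : ∀ {k A} → nth xs k ≡ just A → NonEmptyInterval A
  antichain-nonEmpty {k} = All-nth {k = k} (proj₁ (proj₂ ac))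

  first-unpreceding-⊆ᵢ : ∀ {I s J} → Contains xs I → (∀ k K → k < s → nth xs k ≡ just K → K ≺ I) →
                         nth xs s ≡ just J → J ⊀ I → J ⊆ᵢ I
  first-unpreceding-⊆ᵢ {I} {s} {J} con before eJ J⊀I with Any⇒nth con
  ... | k , K , eK , K⊆I with ⊆ᵢ⇒bounds (antichain-nonEmpty {k} eK) K⊆I | <-cmp k s
  ... | lK , _ | tri< k< _ _ = ⊥-elim (<⇒≱ (proj₁ (before k K k< eK)) lK)
  ... | _ | tri≈ _ refl _ = subst (_⊆ᵢ I) (just-injective (trans (sym eK) eJ)) K⊆I
  ... | _ , rK | tri> _ _ k> with antichain-≺ k> eJ eK | J⊀I
  ...   | _ , r< | inj₁ l≤ = bounds⇒⊆ᵢ l≤ (<⇒≤ (<-≤-trans r< rK))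
  ...   | _ , r< | inj₂ r≤ = ⊥-elim (<⇒≱ (<-≤-trans r< rK) r≤)

record _≤ᶜ_ (c d : Fin 2 → ℕ) : Set where
  constructor _,_
  field
    ≤ᶜ-M : c f0 ≤ d f0
    ≤ᶜ-S : c (fs f0) ≤ d (fs f0)

≤ᶜ-at : ∀ {c d} → c ≤ᶜ d → ∀ i → c i ≤ d i
≤ᶜ-at (le , _) f0 = le
≤ᶜ-at (_ , le) (fs f0) = le

≤ᶜ-trans : ∀ {c d e} → c ≤ᶜ d → d ≤ᶜ e → c ≤ᶜ e
≤ᶜ-trans (a , b) (a' , b') = ≤-trans a a' , ≤-trans b b'

≤ᶜ-bump : ∀ i c → c ≤ᶜ bump i c
≤ᶜ-bump f0 c = n≤1+n _ , ≤-refl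
≤ᶜ-bump (fs f0) c = ≤-refl , n≤1+n _

bump-≤ᶜ : ∀ i {c d} → c i < d i → c ≤ᶜ d → bump i c ≤ᶜ d
bump-≤ᶜ f0 c< (_ , b) = c< , b
bump-≤ᶜ (fs f0) c< (a , _) = a , c<

bump-≤ᶜ⁻ : ∀ i {c d} → bump i c ≤ᶜ d → c i < d i
bump-≤ᶜ⁻ f0 = _≤ᶜ_.≤ᶜ-M
bump-≤ᶜ⁻ (fs f0) = _≤ᶜ_.≤ᶜ-S

reverse-∷-++ : ∀ {A : Set} (acc : List A) o t → reverse (o ∷ acc) ++ t ≡ reverse acc ++ (o ∷ t)
reverse-∷-++ acc o t = trans (cong (_++ t) (unfold-reverse o acc)) (++-assoc (reverse acc) (o ∷ []) t)

module _ {n : ℕ} (I : Input n) where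

  fetch-just⁻ : ∀ c i k {J} → fetch I c i k ≡ just J → k < c i × nth (lst I i) k ≡ just J
  fetch-just⁻ c i k e with k <ᵇ c i in k<ᵇ
  ... | true = <ᵇ⇒< k (c i) (subst T (sym k<ᵇ) tt) , e

  fetch-just : ∀ c i k {J} → k < c i → nth (lst I i) k ≡ just J → fetch I c i k ≡ just J
  fetch-just c i k k< e with k <ᵇ c i in k<ᵇ
  ... | true = e
  ... | false = ⊥-elim (subst T k<ᵇ (<⇒<ᵇ k<))

  deref-fetch : ∀ c i k s → deref I c (ref i k s) ≡ mmap (endpoint s) (fetch I c i k)
  deref-fetch c i k s with fetch I c i k
  ... | just _ = refl
  ... | nothing = refl

  WasRead : Out n → Set
  WasRead o = ∀ J → val o ≡ just J → ∃ λ i → ∃ λ k → k < nread o i × nth (lst I i) k ≡ just J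

  LaterOutput : (Fin 2 → ℕ) → Out n → Set
  LaterOutput c o = c ≤ᶜ nread o × WasRead o

readResponse : ∀ {A : Set} → Maybe A → Response
readResponse (just _) = got
readResponse nothing = null

module _ {n : ℕ} (X : Algorithm) (I : Input n) where

  run-suc : ∀ f h c acc {t} → run f X I h c acc ≡ just t → run (suc f) X I h c acc ≡ just t
  runAct-suc : ∀ f h c acc a {t} → runAct f X I h c acc a ≡ just t →
               runAct (suc f) X I h c acc a ≡ just t
  runRead-suc : ∀ f h c acc i m {t} → runRead f X I h c acc i m ≡ just t →
                runRead (suc f) X I h c acc i m ≡ just t
  runCmp-suc : ∀ f h c acc m m' {t} → runCmp f X I h c acc m m' ≡ just t →
               runCmp (suc f) X I h c acc m m' ≡ just t
  runEmit-suc : ∀ f h c acc m {t} → runEmit f X I h c acc m ≡ just t →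
                runEmit (suc f) X I h c acc m ≡ just t
  run-suc (suc f) h c acc e = runAct-suc f h c acc (X h) e
  runAct-suc f h c acc (read i) e = runRead-suc f h c acc i (nth (lst I i) (c i)) e
  runAct-suc f h c acc (compare a b) e = runCmp-suc f h c acc (deref I c a) (deref I c b) e
  runAct-suc f h c acc (emit i k) e = runEmit-suc f h c acc (fetch I c i k) e
  runAct-suc f h c acc halt e = e
  runRead-suc f h c acc i (just _) e = run-suc f _ _ acc e
  runRead-suc f h c acc i nothing e = run-suc f _ _ acc e
  runCmp-suc f h c acc (just _) (just _) e = run-suc f _ c acc e
  runEmit-suc f h c acc (just _) e = run-suc f _ c _ e

  run-+ : ∀ k f h c acc {t} → run f X I h c acc ≡ just t → run (k + f) X I h c acc ≡ just t
  run-+ zero f h c acc e = e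
  run-+ (suc k) f h c acc e = run-suc (k + f) h c acc (run-+ k f h c acc e)

  run-deterministic : ∀ f f' h c acc {t t'} → run f X I h c acc ≡ just t → run f' X I h c acc ≡ just t' →
                      t ≡ t'
  run-deterministic f f' h c acc e e' = just-injective (begin
    just _            ≡⟨ run-+ f' f h c acc e ⟨
    run (f' + f) X I h c acc ≡⟨ cong (λ z → run z X I h c acc) (+-comm f' f) ⟩
    run (f + f') X I h c acc ≡⟨ run-+ f f' h c acc e' ⟩
    just _            ∎)
    where open ≡-Reasoning

  Runs-deterministic : ∀ {t t'} → Runs X I t → Runs X I t' → t ≡ t'
  Runs-deterministic (f , e) (f' , e') = run-deterministic f f' [] _ [] e e'

  runRead-unfold : ∀ f h c acc i m → runRead f X I h c acc i m ≡ run f X I (readResponse m ∷ h) (bump i c) acc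
  runRead-unfold f h c acc i (just _) = refl
  runRead-unfold f h c acc i nothing = refl

  run-outputs : ∀ f h c acc {t} → run f X I h c acc ≡ just t →
                ∃ λ rest → t ≡ reverse acc ++ rest × All (LaterOutput I c) rest
  runAct-outputs : ∀ f h c acc a {t} → runAct f X I h c acc a ≡ just t →
                   ∃ λ rest → t ≡ reverse acc ++ rest × All (LaterOutput I c) rest
  run-outputs (suc f) h c acc e = runAct-outputs f h c acc (X h) e
  runAct-outputs f h c acc (read i) e
    with run-outputs f _ (bump i c) acc (trans (sym (runRead-unfold f h c acc i (nth (lst I i) (c i)))) e)
  ... | rest , t≡ , later = rest , t≡ , All.map (weaken (≤ᶜ-bump i c)) later
    where
    weaken : ∀ {c d o} → c ≤ᶜ d → LaterOutput I d o → LaterOutput I c o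
    weaken c≤d (d≤ , wr) = ≤ᶜ-trans c≤d d≤ , wr
  runAct-outputs f h c acc (compare a b) e with deref I c a | deref I c b
  ... | just _ | just _ = run-outputs f _ c acc e
  runAct-outputs f h c acc (emit i k) e with fetch I c i k in fetched
  ... | just J with run-outputs f _ c _ e
  ...   | rest , t≡ , later = out (just J) c ∷ rest , trans t≡ (reverse-∷-++ acc _ rest) ,
          ((≤-refl , ≤-refl) , λ { _ refl → i , k , fetch-just⁻ I c i k fetched }) ∷ later
  runAct-outputs f h c acc halt refl =
    out nothing c ∷ [] , unfold-reverse _ acc , ((≤-refl , ≤-refl) , λ _ ()) ∷ []

-- Runs on inputs that agree on everything read so far

relabel : ∀ {n n'} → (Fin n → Fin n') → Interval n → Interval n'
relabel f J = [ f (lft J) ⋯ f (rgt J) ]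

relabelOut : ∀ {n n'} → (Fin n → Fin n') → Out n → Out n'
relabelOut f o = out (mmap (relabel f) (val o)) (nread o)

module Relabelling {n n' : ℕ} (f : Fin n → Fin n') (f-toℕ : ∀ x → toℕ (f x) ≡ toℕ x)
                   (Y : Algorithm) (I : Input n) (I' : Input n') (B : Fin 2 → ℕ)
                   (agree : ∀ i k → k < B i → nth (lst I' i) k ≡ mmap (relabel f) (nth (lst I i) k)) where

  private
    mo = relabelOut f

  AgreeWithin : List (Out n) → List (Out n') → Set
  AgreeWithin tr tr' = ∀ p o → nth tr p ≡ just o → nread o ≤ᶜ B →
                       ∀ q → q ≤ p → nth tr' q ≡ mmap mo (nth tr q)

  fetch-agrees : ∀ {c} → c ≤ᶜ B → ∀ i k → fetch I' c i k ≡ mmap (relabel f) (fetch I c i k)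
  fetch-agrees {c} c≤B i k with k <ᵇ c i in k<ᵇ
  ... | true = agree i k (≤-trans (<ᵇ⇒< k (c i) (subst T (sym k<ᵇ) tt)) (≤ᶜ-at c≤B i))
  ... | false = refl

  deref-agrees : ∀ {c} → c ≤ᶜ B → ∀ r → deref I' c r ≡ mmap f (deref I c r)
  deref-agrees {c} c≤B (ref i k s) = begin
      deref I' c (ref i k s)                       ≡⟨ deref-fetch I' c i k s ⟩
      mmap (endpoint s) (fetch I' c i k)           ≡⟨ cong (mmap (endpoint s)) (fetch-agrees c≤B i k) ⟩
      mmap (endpoint s) (mmap (relabel f) (fetch I c i k)) ≡⟨ endpoint-relabel s (fetch I c i k) ⟩
      mmap f (mmap (endpoint s) (fetch I c i k))   ≡⟨ cong (mmap f) (deref-fetch I c i k s) ⟨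
      mmap f (deref I c (ref i k s))               ∎
    where
    open ≡-Reasoning
    endpoint-relabel : ∀ s m → mmap (endpoint s) (mmap (relabel f) m) ≡ mmap f (mmap (endpoint s) m)
    endpoint-relabel L (just _) = refl
    endpoint-relabel R (just _) = refl
    endpoint-relabel _ nothing = refl

  agree-after-overrun : ∀ f₁ f₂ h h' c acc {tr tr'} → run f₁ Y I h c acc ≡ just tr →
                        run f₂ Y I' h' c (map mo acc) ≡ just tr' → ¬ (c ≤ᶜ B) → AgreeWithin tr tr'
  agree-after-overrun f₁ f₂ h h' c acc e e' c≰B p o np o≤B q q≤p
    with run-outputs Y I f₁ h c acc e | run-outputs Y I' f₂ h' c (map mo acc) e'
  ... | rest , refl , later | rest' , refl , _ with nth-++⁻ (reverse acc) rest p np later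
  ...   | inj₂ (c≤o , _) = ⊥-elim (c≰B (≤ᶜ-trans c≤o o≤B))
  ...   | inj₁ p< = begin
      nth (reverse (map mo acc) ++ rest') q ≡⟨ nth-++ˡ (reverse (map mo acc)) rest' q q<' ⟩
      nth (reverse (map mo acc)) q          ≡⟨ nth-reverse-map mo acc q ⟩
      mmap mo (nth (reverse acc) q)         ≡⟨ cong (mmap mo) (nth-++ˡ (reverse acc) rest q q<) ⟨
      mmap mo (nth (reverse acc ++ rest) q) ∎
    where
    open ≡-Reasoning
    q< = ≤-<-trans q≤p p<
    q<' = subst (q <_) (sym (length-reverse-map mo acc)) q<

  agree-run : ∀ fu h c acc → c ≤ᶜ B → ∀ {tr tr'} → run fu Y I h c acc ≡ just tr →
              run fu Y I' h c (map mo acc) ≡ just tr' → AgreeWithin tr tr'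
  agree-act : ∀ fu h c acc a → c ≤ᶜ B → ∀ {tr tr'} → runAct fu Y I h c acc a ≡ just tr →
              runAct fu Y I' h c (map mo acc) a ≡ just tr' → AgreeWithin tr tr'
  agree-run (suc fu) h c acc c≤B e e' = agree-act fu h c acc (Y h) c≤B e e'
  agree-act fu h c acc (read i) c≤B e e' with c i <? B i
  ... | yes c< = continue (nth (lst I i) (c i)) e
                   (subst (λ m → runRead fu Y I' h c (map mo acc) i m ≡ just _) (agree i (c i) c<) e')
    where
    continue : ∀ m {tr tr'} → runRead fu Y I h c acc i m ≡ just tr →
               runRead fu Y I' h c (map mo acc) i (mmap (relabel f) m) ≡ just tr' → AgreeWithin tr tr'
    continue (just _) e e' = agree-run fu _ (bump i c) acc (bump-≤ᶜ i c< c≤B) e e'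
    continue nothing e e' = agree-run fu _ (bump i c) acc (bump-≤ᶜ i c< c≤B) e e'
  ... | no c≮ = agree-after-overrun fu fu _ _ (bump i c) acc
                   (trans (sym (runRead-unfold Y I fu h c acc i (nth (lst I i) (c i)))) e)
                   (trans (sym (runRead-unfold Y I' fu h c (map mo acc) i (nth (lst I' i) (c i)))) e')
                   (λ b≤ → c≮ (bump-≤ᶜ⁻ i b≤))
  agree-act fu h c acc (compare a b) c≤B e e'
    rewrite deref-agrees c≤B a | deref-agrees c≤B b with deref I c a | deref I c b
  ... | just x | just y rewrite f-toℕ x | f-toℕ y = agree-run fu _ c acc c≤B e e'
  agree-act fu h c acc (emit i k) c≤B e e' rewrite fetch-agrees c≤B i k with fetch I c i k
  ... | just J = agree-run fu (ack ∷ h) c (out (just J) c ∷ acc) c≤B e e'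
  agree-act fu h c acc halt c≤B refl refl p o np o≤B q q≤p = nth-reverse-map mo (out nothing c ∷ acc) q

-- Correctness

module DiffSpec {n : ℕ} (Ms Ss : List (Interval n)) where

  PrecededBy : ℕ → Interval n → Set
  PrecededBy s K = ∀ k J → k < s → nth Ss k ≡ just J → J ≺ K

  PrecededBy-extend : ∀ {s J K} → PrecededBy s K → nth Ss s ≡ just J → J ≺ K → PrecededBy (suc s) K
  PrecededBy-extend {s} {K = K} before eJ J≺K k J' k< eJ' with <-cmp k s
  ... | tri< k<s _ _ = before k J' k<s eJ'
  ... | tri≈ _ refl _ = subst (_≺ K) (just-injective (trans (sym eJ) eJ')) J≺K
  ... | tri> _ _ k>s = ⊥-elim (<⇒≱ k< k>s)

  PrecedingPrefix : ℕ → Interval n → Set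
  PrecedingPrefix b K = b ≤ suc (length Ss) × PrecededBy (pred b) K

  -- The outputs from the point where rest is what is left of M.
  data DiffTrace : List (Interval n) → List (Out n) → Set where
    halted  : ∀ {o} K jK → nth Ms jK ≡ just K → PrecedingPrefix (nread o (fs f0)) K → val o ≡ nothing →
              nread o f0 ≡ suc (length Ms) → DiffTrace [] (o ∷ [])
    emitted : ∀ {I j rest o tr} → ¬ Contains Ss I → nth Ms j ≡ just I → val o ≡ just I →
              nread o f0 ≡ suc j → PrecedingPrefix (nread o (fs f0)) I →
              DiffTrace rest tr → DiffTrace (I ∷ rest) (o ∷ tr)
    skipped : ∀ {I rest tr} → Contains Ss I → DiffTrace rest tr → DiffTrace (I ∷ rest) tr

  DiffTrace⇒IsDiff : ∀ {rest tr} → DiffTrace rest tr →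
                     Σ (List (Interval n)) λ Ls → IsDiff Ss rest Ls × map val tr ≡ terminated Ls
  DiffTrace⇒IsDiff (halted _ _ _ _ v _) = [] , done , cong (_∷ []) v
  DiffTrace⇒IsDiff (emitted nc _ v _ _ dt) with DiffTrace⇒IsDiff dt
  ... | Ls , d , vals = _ ∷ Ls , keep nc d , cong₂ _∷_ v vals
  DiffTrace⇒IsDiff (skipped c dt) with DiffTrace⇒IsDiff dt
  ... | Ls , d , vals = Ls , skip c d , vals

  EmitOutput : Out n → Set
  EmitOutput o = ∃ λ I → ∃ λ j → ¬ Contains Ss I × nth Ms j ≡ just I × val o ≡ just I ×
                 nread o f0 ≡ suc j × PrecedingPrefix (nread o (fs f0)) I

  NullOutput : Out n → Set
  NullOutput o = ∃ λ K → ∃ λ jK → nth Ms jK ≡ just K × PrecedingPrefix (nread o (fs f0)) K ×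
                 val o ≡ nothing × nread o f0 ≡ suc (length Ms)

  DiffTrace-output : ∀ {rest tr} → DiffTrace rest tr → ∀ p {o} → nth tr p ≡ just o →
                     EmitOutput o ⊎ NullOutput o
  DiffTrace-output (halted K jK eK pp v rM) zero refl = inj₂ (K , jK , eK , pp , v , rM)
  DiffTrace-output (emitted nc eI v rM pp _) zero refl = inj₁ (_ , _ , nc , eI , v , rM , pp)
  DiffTrace-output (emitted _ _ _ _ _ dt) (suc p) e = DiffTrace-output dt p e
  DiffTrace-output (skipped _ dt) p e = DiffTrace-output dt p e

cmpℕ-lt⇒< : ∀ a b → cmpℕ a b ≡ lt → a < b
cmpℕ-lt⇒< zero (suc b) _ = s≤s z≤n
cmpℕ-lt⇒< (suc a) (suc b) e = s≤s (cmpℕ-lt⇒< a b e)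

cmpℕ-eq⇒≡ : ∀ a b → cmpℕ a b ≡ eq → a ≡ b
cmpℕ-eq⇒≡ zero zero _ = refl
cmpℕ-eq⇒≡ (suc a) (suc b) e = cong suc (cmpℕ-eq⇒≡ a b e)

cmpℕ-gt⇒> : ∀ a b → cmpℕ a b ≡ gt → b < a
cmpℕ-gt⇒> (suc a) zero _ = s≤s z≤n
cmpℕ-gt⇒> (suc a) (suc b) e = s≤s (cmpℕ-gt⇒> a b e)

cmpℕ-eq⇒≥ : ∀ a b → cmpℕ a b ≡ eq → b ≤ a
cmpℕ-eq⇒≥ a b e = ≤-reflexive (sym (cmpℕ-eq⇒≡ a b e))

cmpℕ-gt⇒≥ : ∀ a b → cmpℕ a b ≡ gt → b ≤ a
cmpℕ-gt⇒≥ a b e = <⇒≤ (cmpℕ-gt⇒> a b e)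

state : List Response → St
state = foldr (λ r σ → updA σ r) (st RM 0 0 false)

updA-≡ : ∀ r {σ σ'} → σ ≡ σ' → updA σ r ≡ updA σ' r
updA-≡ r = cong (λ σ → updA σ r)

module Execution {n : ℕ} (Inp : Input n) (vM : Antichain (M Inp)) (vS : Antichain (S Inp)) where

  Ms = M Inp
  Ss = S Inp
  open DiffSpec Ms Ss

  Completes : List (Interval n) → List Response → (Fin 2 → ℕ) → List (Out n) → Set
  Completes rest h c acc = Σ (List (Out n)) λ tr → DiffTrace rest tr ×
                           Σ ℕ λ fu → run fu diffAlg Inp h c acc ≡ just (reverse acc ++ tr)

  Suffix : ℕ → List (Interval n) → Set
  Suffix j rest = (∀ q → nth Ms (q + j) ≡ nth rest q) × j + length rest ≡ length Ms

  Suffix-tail : ∀ {j I rest} → Suffix j (I ∷ rest) → Suffix (suc j) rest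
  Suffix-tail {j} {I} {rest} (at , len) = (λ q → trans (cong (nth Ms) (+-suc q j)) (at (suc q))) ,
                                          trans (sym (+-suc j (length rest))) len

  PrecedesRest : ℕ → List (Interval n) → Set
  PrecedesRest b rest = ∀ q K → nth rest q ≡ just K → PrecededBy (pred b) K

  -- s non-null elements of S read; ex: whether null has been read from S as well
  SCounter : ℕ → Bool → ℕ → Set
  SCounter s false b = b ≡ s × s ≤ length Ss
  SCounter s true b = b ≡ suc s × s ≡ length Ss

  SomePreceded : ℕ → Set
  SomePreceded b = ∃ λ K → ∃ λ jK → nth Ms jK ≡ just K × PrecedingPrefix b K

  precedes-rest : ∀ {b I j rest} → PrecedingPrefix b I → nth Ms j ≡ just I → Suffix (suc j) rest →
                  PrecedesRest b rest
  precedes-rest {j = j} pp eI (at , _) q K eK k J k< eJ =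
    ≺-trans (proj₂ pp k J k< eJ) (antichain-≺ vM (m≤n+m (suc j) q) eI (trans (at q) eK))

  preceded⇒uncontained : ∀ {I} → PrecededBy (length Ss) I → ¬ Contains Ss I
  preceded⇒uncontained before con with Any⇒nth con
  ... | k , J , eJ , J⊆I =
    ≺⇒⊈ (antichain-nonEmpty vS {k} eJ) (before k J (nth-just⇒< {xs = Ss} {k = k} eJ) eJ) J⊆I

  fetch-current : ∀ c i k {J} → c i ≡ suc k → nth (lst Inp i) k ≡ just J → fetch Inp c i k ≡ just J
  fetch-current c i k ci e = fetch-just Inp c i k (subst (k <_) (sym ci) (n<1+n k)) e

  deref-current : ∀ c i k s {J} → c i ≡ suc k → nth (lst Inp i) k ≡ just J →
                  deref Inp c (ref i k s) ≡ just (endpoint s J)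
  deref-current c i k s ci e = trans (deref-fetch Inp c i k s) (cong (mmap (endpoint s)) (fetch-current c i k ci e))

  after-read : ∀ h {c acc i m rest} → diffAlg h ≡ read i → nth (lst Inp i) (c i) ≡ m →
               Completes rest (readResponse m ∷ h) (bump i c) acc → Completes rest h c acc
  after-read h {c} {acc} {i} act refl (tr , dt , fu , e) = tr , dt , suc fu ,
    subst (λ a → runAct fu diffAlg Inp h c acc a ≡ just _) (sym act)
      (trans (runRead-unfold diffAlg Inp fu h c acc i (nth (lst Inp i) (c i))) e)

  after-compare : ∀ h {c acc r₁ r₂ x y rest} → diffAlg h ≡ compare r₁ r₂ →
                  deref Inp c r₁ ≡ just x → deref Inp c r₂ ≡ just y →
                  Completes rest (cmp (cmpℕ (toℕ x) (toℕ y)) ∷ h) c acc → Completes rest h c acc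
  after-compare h {c} {acc} act d₁ d₂ (tr , dt , fu , e) = tr , dt , suc fu ,
    subst (λ a → runAct fu diffAlg Inp h c acc a ≡ just _) (sym act)
      (subst₂ (λ m₁ m₂ → runCmp fu diffAlg Inp h c acc m₁ m₂ ≡ just _) (sym d₁) (sym d₂) e)

  after-emit : ∀ h {c acc i k J fu tr} → diffAlg h ≡ emit i k → fetch Inp c i k ≡ just J →
               run fu diffAlg Inp (ack ∷ h) c (out (just J) c ∷ acc) ≡
                 just (reverse (out (just J) c ∷ acc) ++ tr) →
               run (suc fu) diffAlg Inp h c acc ≡ just (reverse acc ++ out (just J) c ∷ tr)
  after-emit h {c} {acc} {J = J} {fu} {tr} act fJ e =
    subst (λ a → runAct fu diffAlg Inp h c acc a ≡ just _) (sym act)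
      (subst (λ m → runEmit fu diffAlg Inp h c acc m ≡ just _) (sym fJ)
        (trans e (cong just (reverse-∷-++ acc (out (just J) c) tr))))

  halting : ∀ h {c acc} → diffAlg h ≡ halt →
            run 1 diffAlg Inp h c acc ≡ just (reverse acc ++ out nothing c ∷ [])
  halting h {c} {acc} act =
    subst (λ a → runAct 0 diffAlg Inp h c acc a ≡ _) (sym act) (cong just (unfold-reverse _ acc))

  -- One iteration of the outer loop, deciding the interval I = M[j]; next resumes the outer loop.
  module Deciding (I : Interval n) (rest : List (Interval n)) (j : ℕ) (eI : nth Ms j ≡ just I)
                  (next : ∀ s ex b h c acc → state h ≡ st RM (suc j) s ex → c f0 ≡ suc j → c (fs f0) ≡ b →
                          SCounter s ex b → PrecedingPrefix b I → Completes rest h c acc) where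

    fromLoop : ∀ s ex b h c acc → state h ≡ loopEntry (suc j) s ex → c f0 ≡ suc j → c (fs f0) ≡ b →
               PrecededBy (pred b) I → SCounter s ex b → Completes (I ∷ rest) h c acc
    fromEmit : ∀ s ex b h c acc → state h ≡ st EM (suc j) s ex → c f0 ≡ suc j → c (fs f0) ≡ b →
               PrecedingPrefix b I → ¬ Contains Ss I → SCounter s ex b → Completes (I ∷ rest) h c acc
    fromReadS : ∀ d s h c acc → state h ≡ st RS (suc j) s false → c f0 ≡ suc j → c (fs f0) ≡ s →
                s + d ≡ length Ss → PrecededBy s I → Completes (I ∷ rest) h c acc
    fromLoopTest : ∀ d s J h c acc → state h ≡ st CL (suc j) (suc s) false →
                   c f0 ≡ suc j → c (fs f0) ≡ suc s → suc s + d ≡ length Ss →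
                   nth Ss s ≡ just J → PrecededBy s I → Completes (I ∷ rest) h c acc
    fromLoopTestR : ∀ d s J h c acc → state h ≡ st CR (suc j) (suc s) false →
                    c f0 ≡ suc j → c (fs f0) ≡ suc s → suc s + d ≡ length Ss →
                    nth Ss s ≡ just J → PrecededBy s I → toℕ (lft J) < toℕ (lft I) →
                    Completes (I ∷ rest) h c acc
    fromContainmentTest : ∀ s J h c acc → state h ≡ st C1 (suc j) (suc s) false →
                          c f0 ≡ suc j → c (fs f0) ≡ suc s → suc s ≤ length Ss →
                          nth Ss s ≡ just J → PrecededBy s I → J ⊀ I → Completes (I ∷ rest) h c acc
    fromContainmentTestR : ∀ s J h c acc → state h ≡ st C2 (suc j) (suc s) false →
                           c f0 ≡ suc j → c (fs f0) ≡ suc s → suc s ≤ length Ss →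
                           nth Ss s ≡ just J → PrecededBy s I → J ⊀ I → toℕ (lft I) ≤ toℕ (lft J) →
                           Completes (I ∷ rest) h c acc
    emitIfUncontained : ∀ s J h c acc → state h ≡ st EM (suc j) (suc s) false →
                        c f0 ≡ suc j → c (fs f0) ≡ suc s → suc s ≤ length Ss →
                        nth Ss s ≡ just J → PrecededBy s I → J ⊀ I → ¬ (J ⊆ᵢ I) →
                        Completes (I ∷ rest) h c acc

    fromLoop s true b h c acc q cj cb before (refl , s≡) =
      fromEmit s true (suc s) h c acc q cj cb (s≤s (≤-reflexive s≡) , before)
        (preceded⇒uncontained (subst (λ z → PrecededBy z I) s≡ before)) (refl , s≡)
    fromLoop zero false b h c acc q cj cb _ (refl , _) =
      fromReadS (length Ss) zero h c acc q cj cb refl (λ _ _ ())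
    fromLoop (suc s) false b h c acc q cj cb before (refl , s<) with <⇒nth-just Ss s s<
    ... | J , eJ = fromLoopTest (length Ss ∸ suc s) s J h c acc q cj cb (m+[n∸m]≡n s<) eJ before

    fromEmit s ex b h c acc q cj cb pp nc sc
      with next s ex b (ack ∷ h) c (out (just I) c ∷ acc) (updA-≡ ack q) cj cb sc pp
    ... | tr , dt , fu , e =
      out (just I) c ∷ tr , emitted nc eI refl cj (subst (λ b → PrecedingPrefix b I) (sym cb) pp) dt ,
      suc fu , after-emit h (cong stepA q) (fetch-current c f0 j cj eI) e

    fromReadS zero s h c acc q cj cb sd before =
      after-read h (cong stepA q) S-exhausted
        (fromEmit s true (suc s) (null ∷ h) (bump (fs f0) c) acc (updA-≡ null q) cj (cong suc cb)
          (s≤s (≤-reflexive s≡) , before) (preceded⇒uncontained (subst (λ z → PrecededBy z I) s≡ before))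
          (refl , s≡))
      where
      s≡ : s ≡ length Ss
      s≡ = trans (sym (+-identityʳ s)) sd
      S-exhausted : nth Ss (c (fs f0)) ≡ nothing
      S-exhausted = trans (cong (nth Ss) cb) (length≤⇒nth-nothing Ss s (≤-reflexive (sym s≡)))
    fromReadS (suc d) s h c acc q cj cb sd before with <⇒nth-just Ss s (subst (s <_) sd (m<m+n s (s≤s z≤n)))
    ... | J , eJ = after-read h (cong stepA q) (trans (cong (nth Ss) cb) eJ)
        (fromLoopTest d s J (got ∷ h) (bump (fs f0) c) acc (updA-≡ got q) cj (cong suc cb) (trans (sym (+-suc s d)) sd)
          eJ before)

    fromLoopTest d s J h c acc q cj cb sd eJ before =
      after-compare h (cong stepA q) (deref-current c (fs f0) s L cb eJ) (deref-current c f0 j L cj eI) (branch _ refl)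
      where
      s≤ = subst (suc s ≤_) sd (m≤m+n (suc s) d)
      branch : ∀ r → cmpℕ (toℕ (lft J)) (toℕ (lft I)) ≡ r → Completes (I ∷ rest) (cmp r ∷ h) c acc
      branch lt ce = fromLoopTestR d s J _ c acc (updA-≡ (cmp lt) q) cj cb sd eJ before (cmpℕ-lt⇒< _ _ ce)
      branch eq ce = fromContainmentTest s J _ c acc (updA-≡ (cmp eq) q) cj cb s≤ eJ before
                      (inj₁ (cmpℕ-eq⇒≥ _ _ ce))
      branch gt ce = fromContainmentTest s J _ c acc (updA-≡ (cmp gt) q) cj cb s≤ eJ before
                      (inj₁ (cmpℕ-gt⇒≥ _ _ ce))

    fromLoopTestR d s J h c acc q cj cb sd eJ before l< =
      after-compare h (cong stepA q) (deref-current c (fs f0) s R cb eJ) (deref-current c f0 j R cj eI) (branch _ refl)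
      where
      s≤ = subst (suc s ≤_) sd (m≤m+n (suc s) d)
      branch : ∀ r → cmpℕ (toℕ (rgt J)) (toℕ (rgt I)) ≡ r → Completes (I ∷ rest) (cmp r ∷ h) c acc
      branch lt ce = fromReadS d (suc s) _ c acc (updA-≡ (cmp lt) q) cj cb sd
                      (PrecededBy-extend before eJ (l< , cmpℕ-lt⇒< _ _ ce))
      branch eq ce = fromContainmentTest s J _ c acc (updA-≡ (cmp eq) q) cj cb s≤ eJ before
                      (inj₂ (cmpℕ-eq⇒≥ _ _ ce))
      branch gt ce = fromContainmentTest s J _ c acc (updA-≡ (cmp gt) q) cj cb s≤ eJ before
                      (inj₂ (cmpℕ-gt⇒≥ _ _ ce))

    fromContainmentTest s J h c acc q cj cb s≤ eJ before J⊀I =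
      after-compare h (cong stepA q) (deref-current c f0 j L cj eI) (deref-current c (fs f0) s L cb eJ) (branch _ refl)
      where
      neJ = antichain-nonEmpty vS {s} eJ
      branch : ∀ r → cmpℕ (toℕ (lft I)) (toℕ (lft J)) ≡ r → Completes (I ∷ rest) (cmp r ∷ h) c acc
      branch gt ce = emitIfUncontained s J _ c acc (updA-≡ (cmp gt) q) cj cb s≤ eJ before J⊀I
                      λ J⊆I → <⇒≱ (cmpℕ-gt⇒> _ _ ce) (proj₁ (⊆ᵢ⇒bounds neJ J⊆I))
      branch lt ce = fromContainmentTestR s J _ c acc (updA-≡ (cmp lt) q) cj cb s≤ eJ before J⊀I
                      (<⇒≤ (cmpℕ-lt⇒< _ _ ce))
      branch eq ce = fromContainmentTestR s J _ c acc (updA-≡ (cmp eq) q) cj cb s≤ eJ before J⊀I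
                      (≤-reflexive (cmpℕ-eq⇒≡ _ _ ce))

    fromContainmentTestR s J h c acc q cj cb s≤ eJ before J⊀I l≤ =
      after-compare h (cong stepA q) (deref-current c (fs f0) s R cb eJ) (deref-current c f0 j R cj eI) (branch _ refl)
      where
      neJ = antichain-nonEmpty vS {s} eJ
      pp : PrecedingPrefix (suc s) I
      pp = m≤n⇒m≤1+n s≤ , before
      skip-contained : ∀ {h'} → state h' ≡ st RM (suc j) (suc s) false → J ⊆ᵢ I → Completes (I ∷ rest) h' c acc
      skip-contained q' J⊆I with next (suc s) false (suc s) _ c acc q' cj cb (refl , s≤) pp
      ... | tr , dt , fu , e = tr , skipped (nth⇒Any {k = s} eJ J⊆I) dt , fu , e
      branch : ∀ r → cmpℕ (toℕ (rgt J)) (toℕ (rgt I)) ≡ r → Completes (I ∷ rest) (cmp r ∷ h) c acc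
      branch gt ce = emitIfUncontained s J _ c acc (updA-≡ (cmp gt) q) cj cb s≤ eJ before J⊀I
                      λ J⊆I → <⇒≱ (cmpℕ-gt⇒> _ _ ce) (proj₂ (⊆ᵢ⇒bounds neJ J⊆I))
      branch lt ce = skip-contained (updA-≡ (cmp lt) q) (bounds⇒⊆ᵢ l≤ (<⇒≤ (cmpℕ-lt⇒< _ _ ce)))
      branch eq ce = skip-contained (updA-≡ (cmp eq) q) (bounds⇒⊆ᵢ l≤ (≤-reflexive (cmpℕ-eq⇒≡ _ _ ce)))

    emitIfUncontained s J h c acc q cj cb s≤ eJ before J⊀I J⊈I =
      fromEmit (suc s) false (suc s) h c acc q cj cb (m≤n⇒m≤1+n s≤ , before)
        (λ con → J⊈I (first-unpreceding-⊆ᵢ vS con before eJ J⊀I)) (refl , s≤)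

  fromReadM : ∀ rest j s ex b h c acc → state h ≡ st RM j s ex → c f0 ≡ j → c (fs f0) ≡ b →
              Suffix j rest → PrecedesRest b rest → SCounter s ex b → (rest ≡ [] → SomePreceded b) →
              Completes rest h c acc
  fromReadM [] j s ex b h c acc q cj cb sfx _ _ last with last refl
  ... | K , jK , eK , pp =
    after-read h (cong stepA q) M-exhausted
      (out nothing (bump f0 c) ∷ [] , halted K jK eK (subst (λ b → PrecedingPrefix b K) (sym cb) pp) refl
         (cong suc (trans cj (trans (sym (+-identityʳ j)) (proj₂ sfx)))) ,
       1 , halting (null ∷ h) (cong stepA (updA-≡ null q)))
    where
    M-exhausted : nth Ms (c f0) ≡ nothing
    M-exhausted = trans (cong (nth Ms) cj) (proj₁ sfx 0)
  fromReadM (I ∷ rest) j s ex b h c acc q cj cb sfx pr sc _ =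
    after-read h (cong stepA q) (trans (cong (nth Ms) cj) eI)
      (Deciding.fromLoop I rest j eI continue s ex b (got ∷ h) (bump f0 c) acc (updA-≡ got q)
        (cong suc cj) cb (pr 0 I refl) sc)
    where
    eI : nth Ms j ≡ just I
    eI = proj₁ sfx 0
    continue : ∀ s ex b h c acc → state h ≡ st RM (suc j) s ex → c f0 ≡ suc j → c (fs f0) ≡ b →
               SCounter s ex b → PrecedingPrefix b I → Completes rest h c acc
    continue s ex b h c acc q cj cb sc pp =
      fromReadM rest (suc j) s ex b h c acc q cj cb (Suffix-tail sfx)
        (precedes-rest {rest = rest} pp eI (Suffix-tail sfx)) sc (λ _ → I , j , eI , pp)

  diffTrace : Σ (List (Out n)) λ tr → DiffTrace Ms tr × Runs diffAlg Inp tr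
  diffTrace with fromReadM Ms 0 0 false 0 [] (λ _ → 0) [] refl refl refl ((λ q → cong (nth Ms) (+-identityʳ q)) , refl)
                   (λ _ _ _ _ _ ()) (refl , z≤n) (λ Ms≡[] → ⊥-elim (proj₁ vM Ms≡[]))
  ... | tr , dt , fu , e = tr , dt , fu , e

computesDiff : ComputesDiff diffAlg
computesDiff n Inp (vM , vS) with Execution.diffTrace Inp vM vS
... | tr , dt , runs with DiffSpec.DiffTrace⇒IsDiff (M Inp) (S Inp) dt
... | Ls , d , vals = Ls , d , tr , runs , vals

-- Adding a new maximum to the ordered set

lift : ∀ {n} → Interval n → Interval (suc n)
lift = relabel inject₁

top : ∀ n → Interval (suc n)
top n = [ fromℕ n ⋯ fromℕ n ]

module _ {n : ℕ} where

  inject₁-mono-≤ : ∀ {a b : Fin n} → toℕ a ≤ toℕ b → toℕ (inject₁ a) ≤ toℕ (inject₁ b)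
  inject₁-mono-≤ {a} {b} = subst₂ _≤_ (sym (toℕ-inject₁ a)) (sym (toℕ-inject₁ b))

  inject₁-mono-< : ∀ {a b : Fin n} → toℕ a < toℕ b → toℕ (inject₁ a) < toℕ (inject₁ b)
  inject₁-mono-< {a} {b} = subst₂ _<_ (sym (toℕ-inject₁ a)) (sym (toℕ-inject₁ b))

  inject₁-cancel-≤ : ∀ {a b : Fin n} → toℕ (inject₁ a) ≤ toℕ (inject₁ b) → toℕ a ≤ toℕ b
  inject₁-cancel-≤ {a} {b} = subst₂ _≤_ (toℕ-inject₁ a) (toℕ-inject₁ b)

  inject₁<top : ∀ (a : Fin n) → toℕ (inject₁ a) < toℕ (fromℕ n)
  inject₁<top a = subst (toℕ (inject₁ a) <_) (sym (toℕ-fromℕ n)) (inject₁ℕ< a)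

  lift-injective : ∀ {J K : Interval n} → lift J ≡ lift K → J ≡ K
  lift-injective {[ _ ⋯ _ ]} {[ _ ⋯ _ ]} e =
    cong₂ [_⋯_] (inject₁-injective (cong lft e)) (inject₁-injective (cong rgt e))

  lift≢top : ∀ {J : Interval n} → lift J ≢ top n
  lift≢top {J} e = <-irrefl (cong (λ K → toℕ (lft K)) e) (inject₁<top (lft J))

  lift-nonEmpty : ∀ {J : Interval n} → NonEmptyInterval J → NonEmptyInterval (lift J)
  lift-nonEmpty (x , l , r) = inject₁ x , inject₁-mono-≤ l , inject₁-mono-≤ r

  lift-⊆ᵢ⁻ : ∀ {J K : Interval n} → lift J ⊆ᵢ lift K → J ⊆ᵢ K
  lift-⊆ᵢ⁻ J⊆K x (l , r) with J⊆K (inject₁ x) (inject₁-mono-≤ l , inject₁-mono-≤ r)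
  ... | l' , r' = inject₁-cancel-≤ l' , inject₁-cancel-≤ r'

  lift-≺ : ∀ {J K : Interval n} → J ≺ K → lift J ≺ lift K
  lift-≺ (l , r) = inject₁-mono-< l , inject₁-mono-< r

  lift-unnested : ∀ {J K : Interval n} → Unnested J K → Unnested (lift J) (lift K)
  lift-unnested (l , J⊈K , K⊈J) = inject₁-mono-≤ l , (λ ⊆ → J⊈K (lift-⊆ᵢ⁻ ⊆)) , (λ ⊇ → K⊈J (lift-⊆ᵢ⁻ ⊇))

  lift-≺-top : ∀ (J : Interval n) → lift J ≺ top n
  lift-≺-top J = inject₁<top (lft J) , inject₁<top (rgt J)

  top-nonEmpty : NonEmptyInterval (top n)
  top-nonEmpty = fromℕ n , ≤-refl , ≤-refl

  top⊈lift : ∀ (J : Interval n) → ¬ (top n ⊆ᵢ lift J)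
  top⊈lift J = ≺⇒⊉ top-nonEmpty (lift-≺-top J)

  lift⊈top : ∀ {J : Interval n} → NonEmptyInterval J → ¬ (lift J ⊆ᵢ top n)
  lift⊈top {J} neJ = ≺⇒⊈ (lift-nonEmpty neJ) (lift-≺-top J)

  antichain-lift : ∀ {xs : List (Interval n)} → Antichain xs → Antichain (map lift xs)
  antichain-lift {[]} (xs≢[] , _) = ⊥-elim (xs≢[] refl)
  antichain-lift {_ ∷ _} (_ , ne , ap) =
    (λ ()) , All.map⁺ (All.map lift-nonEmpty ne) , AllPairs.map⁺ (AllPairs.map lift-unnested ap)

antichain-lift-take-∷ʳ : ∀ {n} {xs : List (Interval n)} b {Z} → Antichain xs → NonEmptyInterval Z →
                         All (_≺ Z) (map lift (take b xs)) → Antichain (map lift (take b xs) ∷ʳ Z)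
antichain-lift-take-∷ʳ {xs = xs} b {Z} (_ , ne , ap) neZ before =
  ∷ʳ≢[] , All.++⁺ neYs (neZ ∷ []) ,
  AllPairs.++⁺ (AllPairs.map⁺ (AllPairs.map lift-unnested (AllPairs.take⁺ b ap))) (All.[] ∷ AllPairs.[])
    (All.zipWith (λ (neY , Y≺Z) → ≺⇒unnested neY neZ Y≺Z ∷ []) (neYs , before))
  where
  neYs = All.map⁺ (All.map lift-nonEmpty (All.take⁺ b ne))
  ∷ʳ≢[] : ∀ {ys} → ys ∷ʳ Z ≢ []
  ∷ʳ≢[] {[]} ()
  ∷ʳ≢[] {_ ∷ _} ()

-- Lower bound on the reads of equivalent algorithms

ComputesDiff-FunEquiv : ∀ {X Y} → ComputesDiff X → FunEquiv X Y → ComputesDiff Y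
ComputesDiff-FunEquiv X-diff feq n I v with X-diff n I v
... | Ls , d , computes = Ls , d , Equivalence.to (feq n I v (terminated Ls)) computes

module LowerBound (Y : Algorithm) (Y-diff : ComputesDiff Y) {n : ℕ} (Inp : Input n)
                  (vM : Antichain (M Inp)) (vS : Antichain (S Inp)) (Ls : List (Interval n))
                  (d : IsDiff (S Inp) (M Inp) Ls) (trY : List (Out n)) (runsY : Runs Y Inp trY)
                  (valsY : map val trY ≡ terminated Ls) where

  Ms = M Inp
  Ss = S Inp
  open DiffSpec Ms Ss

  value-at : ∀ p {o} → nth trY p ≡ just o → nth (terminated Ls) p ≡ just (val o)
  value-at p np = trans (cong (λ z → nth z p) (sym valsY)) (trans (nth-map val trY p) (cong (mmap val) np))

  indistinguishable : ∀ (I' : Input (suc n)) → Valid I' → ∀ p {o} → nth trY p ≡ just o →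
                      (∀ k → k < nread o f0 → nth (M I') k ≡ mmap lift (nth Ms k)) →
                      (∀ k → k < nread o (fs f0) → nth (S I') k ≡ mmap lift (nth Ss k)) →
                      Σ (List (Interval (suc n))) λ Ls' → IsDiff (S I') (M I') Ls' ×
                      (∀ q → q ≤ p → nth (terminated Ls') q ≡ mmap (mmap lift) (nth (terminated Ls) q))
  indistinguishable I' v' p {o} np agreeM agreeS with Y-diff (suc n) I' v'
  ... | Ls' , d' , tr' , (f' , e') , vals' = Ls' , d' , λ q q≤p → begin
      nth (terminated Ls') q                           ≡⟨ cong (λ z → nth z q) vals' ⟨
      nth (map val tr') q                              ≡⟨ nth-map val tr' q ⟩
      mmap val (nth tr' q)                             ≡⟨ cong (mmap val) (agrees q q≤p) ⟩
      mmap val (mmap (relabelOut inject₁) (nth trY q)) ≡⟨ val-relabelOut (nth trY q) ⟩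
      mmap (mmap lift) (mmap val (nth trY q))          ≡⟨ cong (mmap (mmap lift)) (nth-map val trY q) ⟨
      mmap (mmap lift) (nth (map val trY) q)           ≡⟨ cong (λ z → mmap (mmap lift) (nth z q)) valsY ⟩
      mmap (mmap lift) (nth (terminated Ls) q)         ∎
    where
    open ≡-Reasoning
    agree : ∀ i k → k < nread o i → nth (lst I' i) k ≡ mmap lift (nth (lst Inp i) k)
    agree f0 = agreeM
    agree (fs f0) = agreeS
    f = proj₁ runsY
    agrees : ∀ q → q ≤ p → nth tr' q ≡ mmap (relabelOut inject₁) (nth trY q)
    agrees = Relabelling.agree-run inject₁ toℕ-inject₁ Y Inp I' (nread o) agree (f' + f) [] (λ _ → 0) []
               (z≤n , z≤n) (run-+ Y Inp f' f [] (λ _ → 0) [] (proj₂ runsY))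
               (subst (λ z → run z Y I' [] (λ _ → 0) [] ≡ just tr') (+-comm f f')
                 (run-+ Y I' f f' [] (λ _ → 0) [] e'))
               p o np (≤-refl , ≤-refl)
    val-relabelOut : ∀ m → mmap val (mmap (relabelOut inject₁) m) ≡ mmap (mmap lift) (mmap val m)
    val-relabelOut (just _) = refl
    val-relabelOut nothing = refl

  emitted-M-read : ∀ p {o} → nth trY p ≡ just o → ∀ {I j} → val o ≡ just I → nth Ms j ≡ just I →
                   ¬ Contains Ss I → suc j ≤ nread o f0
  emitted-M-read p {o} np {I} vo eI nc with run-outputs Y Inp (proj₁ runsY) [] (λ _ → 0) [] (proj₂ runsY)
  ... | rest , refl , later with proj₂ (All-nth {k = p} later np) I vo
  ...   | f0 , k , k< , eI' = subst (λ k → suc k ≤ nread o f0) (antichain-nth-injective vM eI' eI) k<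
  ...   | fs f0 , k , _ , eI' = ⊥-elim (nc (nth⇒Any {k = k} eI' ⊆ᵢ-refl))

  -- With only b elements of M read, Y cannot tell M from its first b elements followed by a new maximum,
  -- which would have to be output before null.
  null-M-read : ∀ p {o} → nth trY p ≡ just o → val o ≡ nothing → suc (length Ms) ≤ nread o f0
  null-M-read p {o} np vo with suc (length Ms) ≤? nread o f0
  ... | yes r = r
  ... | no r with indistinguishable I' v' p np (λ k → nth-map-take-++ lift b Ms (top n ∷ []) k b≤)
                    (λ k _ → nth-map lift Ss k)
    where
    b = nread o f0
    b≤ : b ≤ length Ms
    b≤ = ≤-pred (≰⇒> r)
    I' = input (map lift (take b Ms) ∷ʳ top n) (map lift Ss)
    v' : Valid I'
    v' = antichain-lift-take-∷ʳ b vM top-nonEmpty (All.map⁺ (All.universal lift-≺-top (take b Ms))) , antichain-lift vS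
  ...   | Ls' , d' , agree = ⊥-elim (lift≢top (proj₂ (proj₂ (agreeing-output⁻ lift Ls Ls' p agree null-at-p top∈))))
    where
    null-at-p = trans (value-at p np) (cong just vo)
    top-uncontained : ¬ Contains (map lift Ss) (top n)
    top-uncontained = All.All¬⇒¬Any (All.map⁺ (All.map lift⊈top (proj₁ (proj₂ vS))))
    top∈ = IsDiff-complete d' (nth⇒Any (nth-∷ʳ (map lift (take (nread o f0) Ms)) (top n)) refl) top-uncontained

  prefix≤length : ∀ {b b' K} → PrecedingPrefix b' K → b < b' → b ≤ length Ss
  prefix≤length pp b< = ≤-pred (≤-trans b< (proj₁ pp))

  prefix-≺ : ∀ {b b' K} → PrecedingPrefix b' K → b < b' → All (_≺ lift K) (map lift (take b Ss))
  prefix-≺ {b} pp b< =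
    All.map⁺ (All.map lift-≺ (nth⇒All-take b Ss λ k J k< eJ → proj₂ pp k J (≤-trans k< (<⇒≤pred b<)) eJ))

  -- If Y has output Z having read fewer than b' elements of S, replacing the rest of S by Z goes unnoticed.
  output-S-read : ∀ p {o} → nth trY p ≡ just o → ∀ q {Z jZ b'} → q ≤ p →
                  nth (terminated Ls) q ≡ just (just Z) → nth Ms jZ ≡ just Z → PrecedingPrefix b' Z →
                  b' ≤ nread o (fs f0)
  output-S-read p {o} np q {Z} {jZ} {b'} q≤p outq eZ pp with b' ≤? nread o (fs f0)
  ... | yes r = r
  ... | no r with indistinguishable I' v' p np (λ k _ → nth-map lift Ms k)
                    (λ k → nth-map-take-++ lift b Ss (lift Z ∷ []) k (prefix≤length pp b<))
    where
    b = nread o (fs f0)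
    b< = ≰⇒> r
    I' = input (map lift Ms) (map lift (take b Ss) ∷ʳ lift Z)
    v' : Valid I'
    v' = antichain-lift vM ,
         antichain-lift-take-∷ʳ b vS (lift-nonEmpty (antichain-nonEmpty vM {jZ} eZ)) (prefix-≺ pp b<)
  ...   | Ls' , d' , agree = ⊥-elim (IsDiff-uncontained d' (agreeing-output lift Ls Ls' p agree q q≤p outq)
                               (nth⇒Any (nth-∷ʳ (map lift (take (nread o (fs f0)) Ss)) (lift Z)) ⊆ᵢ-refl))

  -- If K is nested in an element of S beyond what Y has read, Y cannot tell S from its read prefix
  -- followed by a new maximum, in which case K must be output.
  contained-S-read : ∀ p {o} → nth trY p ≡ just o → val o ≡ nothing → ∀ {K jK b'} → nth Ms jK ≡ just K →
                     PrecedingPrefix b' K → Contains Ss K → b' ≤ nread o (fs f0)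
  contained-S-read p {o} np vo {K} {jK} {b'} eK pp con with b' ≤? nread o (fs f0)
  ... | yes r = r
  ... | no r with indistinguishable I' v' p np (λ k _ → nth-map lift Ms k)
                    (λ k → nth-map-take-++ lift b Ss (top n ∷ []) k (prefix≤length pp b<))
    where
    b = nread o (fs f0)
    b< = ≰⇒> r
    I' = input (map lift Ms) (map lift (take b Ss) ∷ʳ top n)
    v' : Valid I'
    v' = antichain-lift vM , antichain-lift-take-∷ʳ b vS top-nonEmpty (All.map⁺ (All.universal lift-≺-top (take b Ss)))
  ...   | Ls' , d' , agree with agreeing-output⁻ lift Ls Ls' p agree (trans (value-at p np) (cong just vo)) liftK∈
    where
    b = nread o (fs f0)
    b< = ≰⇒> r
    liftK∈ : lift K ∈ Ls'
    liftK∈ = IsDiff-complete d' (nth⇒Any {k = jK} (trans (nth-map lift Ms jK) (cong (mmap lift) eK)) refl)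
               (∷ʳ-uncontained (All.map⁺ (All.map lift-nonEmpty (All.take⁺ b (proj₁ (proj₂ vS)))))
                 (prefix-≺ pp b<) (top⊈lift K))
  ...   | K' , K'∈ , liftK'≡ =
    ⊥-elim (IsDiff-uncontained d K'∈ (subst (Contains Ss) (sym (lift-injective liftK'≡)) con))

  null-S-read : ∀ p {o} → nth trY p ≡ just o → val o ≡ nothing → ∀ {K jK b'} → nth Ms jK ≡ just K →
                PrecedingPrefix b' K → b' ≤ nread o (fs f0)
  null-S-read p {o} np vo {K} {jK} eK pp with contains? K (proj₁ (proj₂ vS))
  ... | yes con = contained-S-read p np vo eK pp con
  ... | no nc with ∈⇒terminated-just Ls (IsDiff-complete d (nth⇒Any {k = jK} eK refl) nc)
  ...   | q , q< , outq = output-S-read p np q (subst (q ≤_) (sym p≡) (<⇒≤ q<)) outq eK pp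
    where
    p≡ : p ≡ length Ls
    p≡ = terminated-nothing⁻ Ls p (trans (value-at p np) (cong just vo))

diffAlg-reads-least : ∀ Y → FunEquiv diffAlg Y → ∀ n (I : Input n) → Valid I →
                      ∀ i p a b → Rho diffAlg I i p a → Rho Y I i p b → a ≤ b
diffAlg-reads-least Y feq n Inp (vM , vS) i p _ _ (trX , runsX , oX , nX , refl) (trY , runsY , oY , nY , refl)
  with Execution.diffTrace Inp vM vS
... | tr₀ , dt , runs₀ with DiffSpec.DiffTrace⇒IsDiff (M Inp) (S Inp) dt
                         | Equivalence.to (feq n Inp (vM , vS) (map val tr₀)) (tr₀ , runs₀ , refl)
... | Ls , d , vals₀ | trY' , runsY' , valsY' = bound i (DiffSpec.DiffTrace-output (M Inp) (S Inp) dt p nX₀)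
  where
  open DiffSpec (M Inp) (S Inp)
  valsY : map val trY ≡ terminated Ls
  valsY = trans (cong (map val) (Runs-deterministic Y Inp runsY runsY')) (trans valsY' vals₀)
  open LowerBound Y (ComputesDiff-FunEquiv computesDiff feq) Inp vM vS Ls d trY runsY valsY
  nX₀ : nth tr₀ p ≡ just oX
  nX₀ = subst (λ tr → nth tr p ≡ just oX) (Runs-deterministic diffAlg Inp runsX runs₀) nX
  same-value : val oY ≡ val oX
  same-value = just-injective (trans (sym (value-at p nY))
                 (trans (cong (λ z → nth z p) (sym vals₀)) (trans (nth-map val tr₀ p) (cong (mmap val) nX₀))))
  bound : ∀ i → EmitOutput oX ⊎ NullOutput oX → nread oX i ≤ nread oY i
  bound f0 (inj₁ (I , j , nc , eI , vX , rM , _)) =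
    subst (_≤ nread oY f0) (sym rM) (emitted-M-read p nY (trans same-value vX) eI nc)
  bound (fs f0) (inj₁ (I , j , _ , eI , vX , _ , pp)) =
    output-S-read p nY p ≤-refl (trans (value-at p nY) (cong just (trans same-value vX))) eI pp
  bound f0 (inj₂ (_ , _ , _ , _ , vX , rM)) =
    subst (_≤ nread oY f0) (sym rM) (null-M-read p nY (trans same-value vX))
  bound (fs f0) (inj₂ (K , jK , eK , pp , vX , _)) = null-S-read p nY (trans same-value vX) eK pp

diffAlg-lazy : Lazy diffAlg 0
diffAlg-lazy Y feq n I v i p a b ra rb =
  subst (a ≤_) (sym (+-identityʳ b)) (diffAlg-reads-least Y feq n I v i p a b ra rb)

diffAlg-minimallyLazy : MinimallyLazy diffAlg
diffAlg-minimallyLazy Y feq Y≤ n I v i p a b ra rb =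
  ≤-antisym (Y≤ n I v i p a b ra rb) (diffAlg-reads-least Y feq n I v i p a b ra rb)

diffAlg-optimallyLazy : OptimallyLazy diffAlg
diffAlg-optimallyLazy = 0 , diffAlg-lazy , λ _ ()

mainTheorem13 : ComputesDiff diffAlg × MinimallyLazy diffAlg × OptimallyLazy diffAlg
mainTheorem13 = computesDiff , diffAlg-minimallyLazy , diffAlg-optimallyLazy
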